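{- Let $G=(V,E)$ be a finite connected simple graph with at least one edge which is not a tree having a perfect matching. Then the hypergraph $H(G)$ satisfies $\mathrm{ed}(H(G))\le1$.
   Context: $H(G)=(V',E')$ is the (multi)hypergraph with vertex set $V'=E$ and, for each edge $e=uv\in E$, one hyperedge $f_e\in E'$ consisting of all edges of $G$ incident to $u$ or to $v$ other than $e$ itself. The edge density is $\mathrm{ed}(H)=\max_{\emptyset\neq X\subseteq V'}|E'(X)|/|X|$, where $E'(X)=\{f\in E':f\subseteq X\}$ counted with multiplicity. -}

module Defs where

open import Data.Nat using (ℕ; _+_; _≤_; _<_)
open import Data.Fin using (Fin; zero; suc; inject₁; fromℕ; _≟_)
open import Data.Fin.Subset using (Subset; ∣_∣; _⊆_; Nonempty)
open import Data.Fin.Subset.Properties using (_⊆?_)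
open import Data.Vec using (tabulate)
open import Data.Bool using (Bool; not; _∧_; _∨_)
open import Data.Product using (Σ; _×_; _,_; proj₁; proj₂; ∃)
open import Data.Sum using (_⊎_)
open import Relation.Nullary using (¬_)
open import Relation.Nullary.Decidable using (⌊_⌋)
open import Relation.Binary.PropositionalEquality using (_≡_; _≢_)
open import Relation.Binary.Construct.Closure.ReflexiveTransitive using (Star)
open import Function.Definitions using (Injective)

record Graph (n m : ℕ) : Set where
  field
    ends      : Fin m → Fin n × Fin n
    loopless  : ∀ e → proj₁ (ends e) ≢ proj₂ (ends e)
    noParallel : ∀ e e' →
      ((proj₁ (ends e) ≡ proj₁ (ends e') × proj₂ (ends e) ≡ proj₂ (ends e'))
       ⊎ (proj₁ (ends e) ≡ proj₂ (ends e') × proj₂ (ends e) ≡ proj₁ (ends e')))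
      → e ≡ e'

module _ {n m : ℕ} (G : Graph n m) where
  open Graph G

  Incident : Fin n → Fin m → Set
  Incident v e = v ≡ proj₁ (ends e) ⊎ v ≡ proj₂ (ends e)

  Adj : Fin n → Fin n → Set
  Adj u v = ∃ λ e → (proj₁ (ends e) ≡ u × proj₂ (ends e) ≡ v)
                  ⊎ (proj₁ (ends e) ≡ v × proj₂ (ends e) ≡ u)

  Connected : Set
  Connected = ∀ u v → Star Adj u v

  HasCycle : Set
  HasCycle = Σ ℕ λ k → Σ (Fin (3 + k) → Fin n) λ c →
    Injective _≡_ _≡_ c
    × (∀ (i : Fin (2 + k)) → Adj (c (inject₁ i)) (c (suc i)))
    × Adj (c (fromℕ (2 + k))) (c zero)

  IsTree : Set
  IsTree = Connected × ¬ HasCycle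

  IsPerfectMatching : (Fin m → Set) → Set
  IsPerfectMatching M = ∀ v → Σ (Fin m) λ e → M e × Incident v e
    × (∀ e' → M e' → Incident v e' → e' ≡ e)

  HasPerfectMatching : Set₁
  HasPerfectMatching = Σ (Fin m → Set) IsPerfectMatching

  shareEnd : Fin m → Fin m → Bool
  shareEnd e e' =
    ⌊ proj₁ (ends e) ≟ proj₁ (ends e') ⌋ ∨ ⌊ proj₁ (ends e) ≟ proj₂ (ends e') ⌋
    ∨ ⌊ proj₂ (ends e) ≟ proj₁ (ends e') ⌋ ∨ ⌊ proj₂ (ends e) ≟ proj₂ (ends e') ⌋

  -- The hypergraph H(G): vertex set = edges of G (Fin m); one hyperedge f_e
  -- for each edge e (indexed by e, so multiplicities are kept), consisting
  -- of all edges e' ≠ e incident to an endpoint of e.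
  hyperedge : Fin m → Subset m
  hyperedge e = tabulate λ e' → not ⌊ e' ≟ e ⌋ ∧ shareEnd e e'

  -- E'(X) as a subset of the index set of hyperedges: those e with f_e ⊆ X
  inducedHyperedges : Subset m → Subset m
  inducedHyperedges X = tabulate λ e → ⌊ hyperedge e ⊆? X ⌋

  -- ed(H(G)) ≤ 1, i.e. max over nonempty X of |E'(X)|/|X| is at most 1,
  -- i.e. |E'(X)| ≤ |X| for every nonempty X ⊆ V'.
  EdgeDensityAtMostOne : Set
  EdgeDensityAtMostOne = ∀ (X : Subset m) → Nonempty X →
    ∣ inducedHyperedges X ∣ ≤ ∣ X ∣

{-# OPTIONS --safe #-}
-- Let Y = E'(X) be the edges e with f_e ⊆ X. Two edges of Y ∖ X cannot share an endpoint (one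
-- would lie in the hyperedge of the other, hence in X), so Y ∖ X is a matching I, and every edge
-- adjacent to I lies in X ∖ Y. Hence |Y| ≤ |X| as soon as I injects into the edges adjacent to it.
-- Take a breadth-first tree towards a root r and send e ∈ I to the tree edge leaving its lower
-- endpoint; distinct edges of I have distinct lower endpoints, and a tree edge has only one upper
-- endpoint. If some vertex is not covered by I, it is the root. Otherwise I is a perfect matching,
-- so G is not a tree, and the matching edge at r needs an extra target: an edge outside I and
-- outside the image. It exists because I together with the image is acyclic: for the potential
-- 2 · (height of the low end of the matching edge at v) + [v is its high end], every vertex has at
-- most one of these edges towards a vertex of no larger potential, whereas the vertex of largest
-- potential on a cycle has two.
module Submission where

open import Defs
open import Data.Bool using (Bool; T; _∨_)
open import Data.Bool.Properties using (T-≡; T-∧; T-∨)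
open import Data.Empty using (⊥-elim)
open import Data.Fin using (Fin; zero; suc; fromℕ; inject₁; fromℕ<; _≟_)
open import Data.Fin.Properties using (any?; all?; ¬∀⟶∃¬; suc-injective)
open import Data.Fin.Relation.Unary.Top using (view; ‵fromℕ; ‵inj₁)
open import Data.Fin.Subset using (Subset; _∈_; _∉_; ∣_∣; _-_; inside; outside; _⊂_)
import Data.Fin.Subset as Subset
open import Data.Fin.Subset.Induction using (⊂-wellFounded)
open import Data.Fin.Subset.Properties
  using (_∈?_; _⊆?_; nonempty?; Empty-unique; ∣⊥∣≡0; p─⊥≡p; p─q⊆p; x∈p∧x≢y⇒x∈p-y; x∈p⇒p-x⊂p)
open import Data.List using (allFin)
open import Data.List.Extrema.Nat using (argmax; f[xs]≤f[argmax])
open import Data.List.Membership.Propositional.Properties using (∈-allFin)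
import Data.List.Relation.Unary.All as All
open import Data.Nat using (ℕ; zero; suc; _+_; _*_; _≤_; _<_; z≤n; s≤s)
open import Data.Nat.Properties
  using (≤-refl; ≤-trans; ≤-total; ≤-reflexive; <-irrefl; <-trans; <⇒≱; n<1+n; n≤1+n; *-suc; *-monoʳ-≤; module ≤-Reasoning)
open import Data.Product using (Σ; ∃; ∃₂; _×_; _,_; proj₁; proj₂)
open import Data.Sum using (_⊎_; inj₁; inj₂; swap)
open import Data.Vec.Base using (_∷_; tabulate; here; there)
open import Data.Vec.Properties using (lookup∘tabulate; []=⇒lookup; lookup⇒[]=)
open import Function using (id; _∘_; Equivalence)
open import Induction.WellFounded using (Acc; acc)
open import Level using (0ℓ)
open import Relation.Binary.Construct.Closure.ReflexiveTransitive using (Star; ε; _◅_)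
open import Relation.Binary.PropositionalEquality
  using (_≡_; _≢_; refl; sym; trans; cong; subst)
open import Relation.Nullary using (¬_; Dec; yes; no; contradiction)
open import Relation.Nullary.Decidable using (_×-dec_; _⊎-dec_; ⌊_⌋; toWitness; fromWitness; fromWitnessFalse)
import Relation.Nullary.Decidable as Dec
open import Relation.Unary using (Pred; _⊆_; Decidable; _∖_)
open import Relation.Unary.Properties using (_∩?_; ∁?)

record _↣_ {n : ℕ} (P Q : Pred (Fin n) 0ℓ) : Set where
  field
    to           : ∀ {x} → P x → Fin n
    to-∈         : ∀ {x} (px : P x) → Q (to px)
    to-injective : ∀ {x y} (px : P x) (py : P y) → to px ≡ to py → x ≡ y

↣-mono : ∀ {n} {P Q R : Pred (Fin n) 0ℓ} → Q ⊆ R → P ↣ Q → P ↣ R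
↣-mono Q⊆R f = record { to = to ; to-∈ = Q⊆R ∘ to-∈ ; to-injective = to-injective }
  where open _↣_ f

∖↣∖⇒↣ : ∀ {n} {P Q : Pred (Fin n) 0ℓ} → Decidable Q → (P ∖ Q) ↣ (Q ∖ P) → P ↣ Q
∖↣∖⇒↣ {n} {P} {Q} Q? f = record
  { to           = λ px → move px (Q? _)
  ; to-∈         = λ px → move-∈ px (Q? _)
  ; to-injective = λ px py → move-injective px py (Q? _) (Q? _)
  }
  where
  open _↣_ f
  move : ∀ {x} → P x → Dec (Q x) → Fin n
  move {x} _ (yes _) = x
  move px (no ¬qx) = to (px , ¬qx)
  move-∈ : ∀ {x} (px : P x) (qx? : Dec (Q x)) → Q (move px qx?)
  move-∈ _  (yes qx)  = qx
  move-∈ px (no ¬qx) = proj₁ (to-∈ (px , ¬qx))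
  move-injective : ∀ {x y} (px : P x) (py : P y) qx? qy? → move px qx? ≡ move py qy? → x ≡ y
  move-injective _  _  (yes _)   (yes _)   x≡y = x≡y
  move-injective px py (no ¬qx)  (no ¬qy)  eq  = to-injective (px , ¬qx) (py , ¬qy) eq
  move-injective px py (yes _)   (no ¬qy)  eq  = contradiction (subst P eq px) (proj₂ (to-∈ (py , ¬qy)))
  move-injective px py (no ¬qx)  (yes _)   eq  = contradiction (subst P (sym eq) py) (proj₂ (to-∈ (px , ¬qx)))

x∉p-x : ∀ {n} {p : Subset n} x → x ∉ p - x
x∉p-x {p = _ ∷ p} zero    ()
x∉p-x {p = _ ∷ p} (suc x) (there x∈p-x) = x∉p-x x x∈p-x

x∈p⇒∣p∣≡1+∣p-x∣ : ∀ {n} {p : Subset n} {x} → x ∈ p → ∣ p ∣ ≡ suc ∣ p - x ∣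
x∈p⇒∣p∣≡1+∣p-x∣ {p = inside ∷ p}  here        = cong suc (cong ∣_∣ (sym (p─⊥≡p p)))
x∈p⇒∣p∣≡1+∣p-x∣ {p = inside ∷ p}  (there x∈p) = cong suc (x∈p⇒∣p∣≡1+∣p-x∣ x∈p)
x∈p⇒∣p∣≡1+∣p-x∣ {p = outside ∷ p} (there x∈p) = x∈p⇒∣p∣≡1+∣p-x∣ x∈p

↣-remove : ∀ {n} {p q : Subset n} (f : (_∈ p) ↣ (_∈ q)) {x} (x∈p : x ∈ p) →
           (_∈ p - x) ↣ (_∈ q - _↣_.to f x∈p)
↣-remove {p = p} f {x} x∈p = record
  { to           = to ∘ ⊆p
  ; to-∈         = λ y∈ → x∈p∧x≢y⇒x∈p-y (to-∈ (⊆p y∈))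
                            λ eq → x∉p-x x (subst (_∈ p - x) (to-injective _ _ eq) y∈)
  ; to-injective = λ y∈ z∈ → to-injective (⊆p y∈) (⊆p z∈)
  }
  where
  open _↣_ f
  ⊆p = p─q⊆p p _

↣⇒∣p∣≤∣q∣ : ∀ {n} {p q : Subset n} → (_∈ p) ↣ (_∈ q) → ∣ p ∣ ≤ ∣ q ∣
↣⇒∣p∣≤∣q∣ = go (⊂-wellFounded _)
  where
  go : ∀ {n} {p q : Subset n} → Acc _⊂_ p → (_∈ p) ↣ (_∈ q) → ∣ p ∣ ≤ ∣ q ∣
  go {n} {p} {q} (acc rec) f with nonempty? p
  ... | no p-empty rewrite Empty-unique p-empty | ∣⊥∣≡0 n = z≤n
  ... | yes (x , x∈p) = begin
    ∣ p ∣          ≡⟨ x∈p⇒∣p∣≡1+∣p-x∣ x∈p ⟩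
    suc ∣ p - x ∣  ≤⟨ s≤s (go (rec (x∈p⇒p-x⊂p x∈p)) (↣-remove f x∈p)) ⟩
    suc ∣ q - y ∣  ≡⟨ x∈p⇒∣p∣≡1+∣p-x∣ (to-∈ x∈p) ⟨
    ∣ q ∣          ∎
    where
    open ≤-Reasoning
    open _↣_ f
    y = to x∈p

∨ˡ : ∀ {x y} → T x → T (x ∨ y)
∨ˡ = Equivalence.from T-∨ ∘ inj₁

∨ʳ : ∀ x {y} → T y → T (x ∨ y)
∨ʳ _ = Equivalence.from T-∨ ∘ inj₂

∈-tabulate⁺ : ∀ {n} {f : Fin n → Bool} {x} → T (f x) → x ∈ tabulate f
∈-tabulate⁺ {f = f} {x} t = lookup⇒[]= x _ (trans (lookup∘tabulate f x) (Equivalence.to T-≡ t))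

∈-tabulate⁻ : ∀ {n} {f : Fin n → Bool} {x} → x ∈ tabulate f → T (f x)
∈-tabulate⁻ {f = f} {x} x∈ = Equivalence.from T-≡ (trans (sym (lookup∘tabulate f x)) ([]=⇒lookup x∈))

least-witness : ∀ {ℓ} {P : Pred ℕ ℓ} → Decidable P → ∀ {k} → P k → ∃ λ i → P i × (∀ {j} → P j → i ≤ j)
least-witness P? {zero} p0 = zero , p0 , λ _ → z≤n
least-witness P? {suc k} pk with P? zero
... | yes p0 = zero , p0 , λ _ → z≤n
... | no ¬p0 with least-witness (P? ∘ suc) pk
...   | i , pi , minimal = suc i , pi , λ { {zero} p0 → contradiction p0 ¬p0 ; {suc j} pj → s≤s (minimal pj) }

argmax-Fin : ∀ {N} (f : Fin (suc N) → ℕ) → ∃ λ i → ∀ j → f j ≤ f i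
argmax-Fin f = argmax f zero (allFin _) , λ j → All.lookup (f[xs]≤f[argmax] {f = f} zero (allFin _)) (∈-allFin j)

suc-inject₁²≢ : ∀ {N} (j : Fin N) → suc (suc j) ≢ inject₁ (inject₁ j)
suc-inject₁²≢ zero    ()
suc-inject₁²≢ (suc j) eq = suc-inject₁²≢ j (suc-injective eq)

module _ {n m : ℕ} (G : Graph n m) where
  open Graph G

  end₁ end₂ : Fin m → Fin n
  end₁ e = proj₁ (ends e)
  end₂ e = proj₂ (ends e)

  Joins : Fin m → Fin n → Fin n → Set
  Joins e u v = (end₁ e ≡ u × end₂ e ≡ v) ⊎ (end₁ e ≡ v × end₂ e ≡ u)

  joins-sym : ∀ {e u v} → Joins e u v → Joins e v u
  joins-sym = swap

  joins-incident : ∀ {e u v} → Joins e u v → Incident G u e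
  joins-incident (inj₁ (refl , _)) = inj₁ refl
  joins-incident (inj₂ (_ , refl)) = inj₂ refl

  joins-≢ : ∀ {e u v} → Joins e u v → u ≢ v
  joins-≢ {e} (inj₁ (refl , refl)) u≡v = loopless e u≡v
  joins-≢ {e} (inj₂ (refl , refl)) u≡v = loopless e (sym u≡v)

  joins-endpoint : ∀ {e u v w} → Joins e u v → Incident G w e → w ≡ u ⊎ w ≡ v
  joins-endpoint (inj₁ (refl , refl)) = id
  joins-endpoint (inj₂ (refl , refl)) = swap

  joins-unique : ∀ {e u v w} → Joins e u v → Joins e u w → v ≡ w
  joins-unique j k with joins-endpoint j (joins-incident (joins-sym k))
  ... | inj₁ w≡u = contradiction (sym w≡u) (joins-≢ k)
  ... | inj₂ w≡v = sym w≡v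

  adj? : ∀ u v → Dec (Adj G u v)
  adj? u v = any? λ e → (end₁ e ≟ u ×-dec end₂ e ≟ v) ⊎-dec (end₁ e ≟ v ×-dec end₂ e ≟ u)

  incident? : ∀ v e → Dec (Incident G v e)
  incident? v e = (v ≟ end₁ e) ⊎-dec (v ≟ end₂ e)

  adj-sym : ∀ {u v} → Adj G u v → Adj G v u
  adj-sym (e , j) = e , joins-sym j

  cycle-neighbours : ∀ {k} (c : Fin (3 + k) → Fin n) →
    (∀ (i : Fin (2 + k)) → Adj G (c (inject₁ i)) (c (suc i))) → Adj G (c (fromℕ (2 + k))) (c zero) →
    ∀ i → ∃₂ λ j j′ → j ≢ j′ × Adj G (c i) (c j) × Adj G (c i) (c j′)
  cycle-neighbours {k} c step close zero = suc zero , fromℕ (2 + k) , (λ ()) , step zero , adj-sym close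
  cycle-neighbours {k} c step close (suc i) with view i
  ... | ‵fromℕ          = zero , inject₁ (fromℕ (1 + k)) , (λ ()) , close , adj-sym (step (fromℕ (1 + k)))
  ... | ‵inj₁ {i = j} _ = suc (suc j) , inject₁ (inject₁ j) , suc-inject₁²≢ j , step (suc j) , adj-sym (step (inject₁ j))

  Descends : (Fin n → ℕ) → Fin n → Pred (Fin m) 0ℓ
  Descends ρ v g = ∃ λ u → Joins g v u × ρ u ≤ ρ v

  cycle⇒two-descents : (ρ : Fin n → ℕ) → HasCycle G →
                       ∃ λ v → ∃₂ λ g g′ → g ≢ g′ × Descends ρ v g × Descends ρ v g′
  cycle⇒two-descents ρ (k , c , c-injective , step , close) =
    let top , maximal = argmax-Fin (ρ ∘ c)
        j , j′ , j≢j′ , (g , jg) , (g′ , jg′) = cycle-neighbours c step close top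
    in  c top , g , g′ , (λ g≡g′ → j≢j′ (c-injective (joins-unique jg (subst (λ h → Joins h (c top) (c j′)) (sym g≡g′) jg′))))
      , (c j , jg , maximal j) , (c j′ , jg′ , maximal j′)

  unique-descent⇒acyclic : (ρ : Fin n → ℕ) →
    (∀ {v g g′} → Descends ρ v g → Descends ρ v g′ → g ≡ g′) → ¬ HasCycle G
  unique-descent⇒acyclic ρ unique cycle =
    let _ , _ , _ , g≢g′ , dg , dg′ = cycle⇒two-descents ρ cycle in g≢g′ (unique dg dg′)

  Neighbours : Fin m → Fin m → Set
  Neighbours e g = g ≢ e × ∃ λ v → Incident G v e × Incident G v g

  neighbours-sym : ∀ {e g} → Neighbours e g → Neighbours g e
  neighbours-sym (g≢e , v , ve , vg) = g≢e ∘ sym , v , vg , ve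

  record Descent (r : Fin n) : Set where
    field
      height  : Fin n → ℕ
      descend : ∀ v → v ≢ r → ∃ λ u → Adj G v u × height u < height v

  module _ (r : Fin n) where

    WalkOfLength : ℕ → Pred (Fin n) 0ℓ
    WalkOfLength zero    v = v ≡ r
    WalkOfLength (suc k) v = ∃ λ u → Adj G v u × WalkOfLength k u

    walkOfLength? : ∀ k → Decidable (WalkOfLength k)
    walkOfLength? zero    v = v ≟ r
    walkOfLength? (suc k) v = any? λ u → adj? v u ×-dec walkOfLength? k u

    star⇒walkOfLength : ∀ {v} → Star (Adj G) v r → ∃ λ k → WalkOfLength k v
    star⇒walkOfLength ε       = zero , refl
    star⇒walkOfLength (a ◅ s) = let k , w = star⇒walkOfLength s in suc k , _ , a , w

    connected⇒descent : Connected G → Descent r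
    connected⇒descent conn = record { height = distance ; descend = descend }
      where
      shortest : ∀ v → ∃ λ k → WalkOfLength k v × (∀ {j} → WalkOfLength j v → k ≤ j)
      shortest v = least-witness (λ k → walkOfLength? k v) (proj₂ (star⇒walkOfLength (conn v r)))
      distance : Fin n → ℕ
      distance v = proj₁ (shortest v)
      descend : ∀ v → v ≢ r → ∃ λ u → Adj G v u × distance u < distance v
      descend v v≢r with shortest v
      ... | zero  , v≡r , _            = contradiction v≡r v≢r
      ... | suc k , (u , uv , walk) , _ = u , uv , s≤s (proj₂ (proj₂ (shortest u)) walk)

  module Rooted {r : Fin n} (D : Descent r) where
    open Descent D public

    parent : ∀ v → v ≢ r → Fin m
    parent v v≢r = proj₁ (proj₁ (proj₂ (descend v v≢r)))

    parent-joins : ∀ v (v≢r : v ≢ r) → ∃ λ u → Joins (parent v v≢r) v u × height u < height v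
    parent-joins v v≢r = let u , (_ , j) , u<v = descend v v≢r in u , j , u<v

    higher-end-unique : ∀ {g v v′ w w′} → Joins g v v′ → Joins g w w′ →
                        height v′ < height v → height w′ < height w → v ≡ w
    higher-end-unique {v = v} {w = w} jv jw v′<v w′<w with joins-endpoint jv (joins-incident jw)
    ... | inj₁ w≡v  = sym w≡v
    ... | inj₂ refl = contradiction (<-trans (subst (λ x → height x < height w) (sym v≡w′) w′<w) v′<v) (<-irrefl refl)
      where
      v≡w′ = joins-unique (joins-sym jv) jw

    parent-injective : ∀ {v w} (v≢r : v ≢ r) (w≢r : w ≢ r) → parent v v≢r ≡ parent w w≢r → v ≡ w
    parent-injective {v} {w} v≢r w≢r eq =
      let _  , jv , v′<v = parent-joins v v≢r
          w′ , jw , w′<w = parent-joins w w≢r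
      in  higher-end-unique jv (subst (λ g → Joins g w w′) (sym eq) jw) v′<v w′<w

    lowEnd : ∀ e → ∃ λ w → Incident G w e × (∀ {x} → Incident G x e → height w ≤ height x)
    lowEnd e with ≤-total (height (end₁ e)) (height (end₂ e))
    ... | inj₁ h₁≤h₂ = end₁ e , inj₁ refl , λ { (inj₁ refl) → ≤-refl ; (inj₂ refl) → h₁≤h₂ }
    ... | inj₂ h₂≤h₁ = end₂ e , inj₂ refl , λ { (inj₁ refl) → h₂≤h₁ ; (inj₂ refl) → ≤-refl }

    low : Fin m → Fin n
    low e = proj₁ (lowEnd e)

    low-incident : ∀ e → Incident G (low e) e
    low-incident e = proj₁ (proj₂ (lowEnd e))

    low-minimal : ∀ {e x} → Incident G x e → height (low e) ≤ height x
    low-minimal {e} = proj₂ (proj₂ (lowEnd e))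

    parent-low-neighbour : ∀ {e} (low≢r : low e ≢ r) → Neighbours e (parent (low e) low≢r)
    parent-low-neighbour {e} low≢r =
      let u , j , u<low = parent-joins (low e) low≢r
      in  (λ parent≡e → <⇒≱ u<low (low-minimal (joins-incident (joins-sym (subst (λ g → Joins g (low e) u) parent≡e j)))))
        , low e , low-incident e , joins-incident j

  IsMatching : Pred (Fin m) 0ℓ → Set
  IsMatching M = ∀ {e f v} → M e → M f → Incident G v e → Incident G v f → e ≡ f

  Covers : Pred (Fin m) 0ℓ → Pred (Fin n) 0ℓ
  Covers M v = ∃ λ e → M e × Incident G v e

  covers? : ∀ {M} → Decidable M → Decidable (Covers M)
  covers? M? v = any? λ e → M? e ×-dec incident? v e

  Boundary : Pred (Fin m) 0ℓ → Pred (Fin m) 0ℓ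
  Boundary M g = ∃ λ e → M e × Neighbours e g

  module _ {r : Fin n} (D : Descent r) {M : Pred (Fin m) 0ℓ} (matching : IsMatching M) where
    open Rooted D

    parent-low-injective : ∀ {a b} (ma : M a) (mb : M b) (la≢r : low a ≢ r) (lb≢r : low b ≢ r) →
                           parent (low a) la≢r ≡ parent (low b) lb≢r → a ≡ b
    parent-low-injective {a} {b} ma mb la≢r lb≢r eq =
      matching ma mb (low-incident a)
        (subst (λ v → Incident G v b) (sym (parent-injective la≢r lb≢r eq)) (low-incident b))

    uncovered-root↣boundary : ¬ Covers M r → M ↣ Boundary M
    uncovered-root↣boundary r-uncovered = record
      { to           = λ {e} me → parent (low e) (low≢r me)
      ; to-∈         = λ {e} me → e , me , parent-low-neighbour (low≢r me)
      ; to-injective = λ ma mb → parent-low-injective ma mb (low≢r ma) (low≢r mb)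
      }
      where
      low≢r : ∀ {e} → M e → low e ≢ r
      low≢r {e} me low≡r = r-uncovered (e , me , subst (λ v → Incident G v e) low≡r (low-incident e))

    module Perfect (M? : Decidable M) (covers : ∀ v → Covers M v) where

      mate : Fin n → Fin m
      mate v = proj₁ (covers v)

      mate-∈ : ∀ v → M (mate v)
      mate-∈ v = proj₁ (proj₂ (covers v))

      mate-incident : ∀ v → Incident G v (mate v)
      mate-incident v = proj₂ (proj₂ (covers v))

      mate-unique : ∀ {e v} → M e → Incident G v e → e ≡ mate v
      mate-unique me ve = matching me (mate-∈ _) ve (mate-incident _)

      isPerfectMatching : IsPerfectMatching G M
      isPerfectMatching v = mate v , mate-∈ v , mate-incident v , λ _ me ve → mate-unique me ve

      IsLow : Pred (Fin n) 0ℓ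
      IsLow v = low (mate v) ≡ v

      potential : Fin n → ℕ
      potential v with low (mate v) ≟ v
      ... | yes _ = 2 * height v
      ... | no  _ = suc (2 * height (low (mate v)))

      potential-low : ∀ {v} → IsLow v → potential v ≡ 2 * height v
      potential-low {v} v-low with low (mate v) ≟ v
      ... | yes _      = refl
      ... | no  ¬v-low = contradiction v-low ¬v-low

      potential-high : ∀ {v} → ¬ IsLow v → potential v ≡ suc (2 * height (low (mate v)))
      potential-high {v} ¬v-low with low (mate v) ≟ v
      ... | yes v-low = contradiction v-low ¬v-low
      ... | no  _     = refl

      potential≤ : ∀ v → potential v ≤ suc (2 * height v)
      potential≤ v with low (mate v) ≟ v
      ... | yes _ = n≤1+n _
      ... | no  _ = s≤s (*-monoʳ-≤ 2 (low-minimal (mate-incident v)))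

      -- All proofs of v ≢ r are definitionally equal (⊥ is proof-irrelevant), so parent v does
      -- not depend on the proof; parentEdge? and tree-descent-unique rely on this.
      ParentEdge : Fin n → Pred (Fin m) 0ℓ
      ParentEdge v g = Σ (v ≢ r) λ v≢r → parent v v≢r ≡ g

      InTree : Pred (Fin m) 0ℓ
      InTree g = M g ⊎ ∃ λ v → IsLow v × ParentEdge v g

      parentEdge? : ∀ v → Decidable (ParentEdge v)
      parentEdge? v g with v ≟ r
      ... | yes v≡r = no λ (v≢r , _) → v≢r v≡r
      ... | no  v≢r = Dec.map′ (v≢r ,_) proj₂ (parent v v≢r ≟ g)

      inTree? : Decidable InTree
      inTree? g = M? g ⊎-dec any? λ v → (low (mate v) ≟ v) ×-dec parentEdge? v g

      mate-descent : ∀ {g v} → M g → Descends potential v g → g ≡ mate v × ¬ IsLow v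
      mate-descent {g} {v} mg (u , j , pu≤pv) = g≡mate-v , v-high
        where
        g≡mate-v = mate-unique mg (joins-incident j)
        g≡mate-u = mate-unique mg (joins-incident (joins-sym j))
        v-high : ¬ IsLow v
        v-high v-low = <⇒≱ (begin-strict
          potential v                      ≡⟨ potential-low v-low ⟩
          2 * height v                     <⟨ n<1+n _ ⟩
          suc (2 * height v)               ≡⟨ cong (λ x → suc (2 * height x)) low-mate-u≡v ⟨
          suc (2 * height (low (mate u)))  ≡⟨ potential-high (λ u-low → joins-≢ j (trans (sym low-mate-u≡v) u-low)) ⟨
          potential u                      ∎) pu≤pv
          where
          open ≤-Reasoning
          low-mate-u≡v : low (mate u) ≡ v
          low-mate-u≡v = trans (cong low (trans (sym g≡mate-u) g≡mate-v)) v-low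

      parent-descent : ∀ {v w} → IsLow w → (w≢r : w ≢ r) → Descends potential v (parent w w≢r) → v ≡ w
      parent-descent {v} {w} w-low w≢r (u , j , pu≤pv) with parent-joins w w≢r
      ... | w′ , jw , w′<w with joins-endpoint jw (joins-incident j)
      ... | inj₁ v≡w  = v≡w
      ... | inj₂ refl = contradiction pu≤pv (<⇒≱ (begin-strict
            potential v         ≤⟨ potential≤ v ⟩
            suc (2 * height v)  <⟨ ≤-trans (≤-reflexive (sym (*-suc 2 (height v)))) (*-monoʳ-≤ 2 w′<w) ⟩
            2 * height w        ≡⟨ cong (λ x → 2 * height x) w≡u ⟩
            2 * height u        ≡⟨ potential-low (subst IsLow w≡u w-low) ⟨
            potential u         ∎))
        where
        open ≤-Reasoning
        w≡u = joins-unique (joins-sym jw) j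

      tree-descent : ∀ {g v} → InTree g → Descends potential v g →
                     (g ≡ mate v × ¬ IsLow v) ⊎ (IsLow v × ParentEdge v g)
      tree-descent (inj₁ mg) dg = inj₁ (mate-descent mg dg)
      tree-descent (inj₂ (w , w-low , w≢r , refl)) dg with parent-descent w-low w≢r dg
      ... | refl = inj₂ (w-low , w≢r , refl)

      tree-descent-unique : ∀ {v g g′} → InTree g → InTree g′ →
                            Descends potential v g → Descends potential v g′ → g ≡ g′
      tree-descent-unique tg tg′ dg dg′ with tree-descent tg dg | tree-descent tg′ dg′
      ... | inj₁ (g≡mate , _)     | inj₁ (g′≡mate , _)   = trans g≡mate (sym g′≡mate)
      ... | inj₂ (_ , _ , parent≡g) | inj₂ (_ , _ , parent≡g′) = trans (sym parent≡g) parent≡g′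
      ... | inj₁ (_ , ¬v-low)     | inj₂ (v-low , _)     = contradiction v-low ¬v-low
      ... | inj₂ (v-low , _)      | inj₁ (_ , ¬v-low)    = contradiction v-low ¬v-low

      all-in-tree⇒acyclic : (∀ g → InTree g) → ¬ HasCycle G
      all-in-tree⇒acyclic all-in-tree =
        unique-descent⇒acyclic potential λ dg dg′ → tree-descent-unique (all-in-tree _) (all-in-tree _) dg dg′

      parent-low-in-tree : ∀ {e} → M e → (low≢r : low e ≢ r) → InTree (parent (low e) low≢r)
      parent-low-in-tree {e} me low≢r = inj₂ (low e , cong low (sym (mate-unique me (low-incident e))) , low≢r , refl)

      non-tree-edge↣boundary : ∀ {x} → ¬ InTree x → M ↣ Boundary M
      non-tree-edge↣boundary {x} x∉tree = record
        { to           = λ {e} me → assign me (low e ≟ r)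
        ; to-∈         = λ {e} me → assign-∈ me (low e ≟ r)
        ; to-injective = λ {a} {b} ma mb → assign-injective ma mb (low a ≟ r) (low b ≟ r)
        }
        where
        assign : ∀ {e} → M e → Dec (low e ≡ r) → Fin m
        assign     _ (yes _)     = x
        assign {e} _ (no low≢r) = parent (low e) low≢r

        assign-∈ : ∀ {e} (me : M e) low≡r? → Boundary M (assign me low≡r?)
        assign-∈ _ (yes _) =
          mate (end₁ x) , mate-∈ _ , (λ x≡mate → x∉tree (inj₁ (subst M (sym x≡mate) (mate-∈ _))))
          , end₁ x , mate-incident _ , inj₁ refl
        assign-∈ {e} me (no low≢r) = e , me , parent-low-neighbour low≢r

        assign-injective : ∀ {a b} (ma : M a) (mb : M b) la≡r? lb≡r? → assign ma la≡r? ≡ assign mb lb≡r? → a ≡ b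
        assign-injective {a} {b} ma mb (yes la≡r) (yes lb≡r) _ =
          matching ma mb (low-incident a) (subst (λ v → Incident G v b) (trans lb≡r (sym la≡r)) (low-incident b))
        assign-injective ma mb (no la≢r) (no lb≢r) eq = parent-low-injective ma mb la≢r lb≢r eq
        assign-injective ma mb (yes _) (no lb≢r) eq = ⊥-elim (x∉tree (subst InTree (sym eq) (parent-low-in-tree mb lb≢r)))
        assign-injective ma mb (no la≢r) (yes _) eq = ⊥-elim (x∉tree (subst InTree eq (parent-low-in-tree ma la≢r)))

      perfect↣boundary : Connected G → ¬ (IsTree G × IsPerfectMatching G M) → M ↣ Boundary M
      perfect↣boundary conn not-tree with all? inTree?
      ... | yes all-in-tree = contradiction ((conn , all-in-tree⇒acyclic all-in-tree) , isPerfectMatching) not-tree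
      ... | no ¬all-in-tree = non-tree-edge↣boundary (proj₂ (¬∀⟶∃¬ m InTree inTree? ¬all-in-tree))

  matching↣boundary : Fin n → Connected G → {M : Pred (Fin m) 0ℓ} → Decidable M → IsMatching M →
                      ¬ (IsTree G × IsPerfectMatching G M) → M ↣ Boundary M
  matching↣boundary r conn {M} M? matching not-tree with all? (covers? M?)
  ... | yes covers = Perfect.perfect↣boundary (connected⇒descent r conn) matching M? covers conn not-tree
  ... | no ¬covers =
    let r′ , r′-uncovered = ¬∀⟶∃¬ n (Covers M) (covers? M?) ¬covers
    in  uncovered-root↣boundary (connected⇒descent r′ conn) matching r′-uncovered

  shareEnd-incident : ∀ {v e g} → Incident G v e → Incident G v g → T (shareEnd G e g)
  shareEnd-incident {e = e} {g} (inj₁ refl) (inj₁ eq) = ∨ˡ (fromWitness {a? = end₁ e ≟ end₁ g} eq)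
  shareEnd-incident {e = e} {g} (inj₁ refl) (inj₂ eq) =
    ∨ʳ ⌊ end₁ e ≟ end₁ g ⌋ (∨ˡ (fromWitness {a? = end₁ e ≟ end₂ g} eq))
  shareEnd-incident {e = e} {g} (inj₂ refl) (inj₁ eq) =
    ∨ʳ ⌊ end₁ e ≟ end₁ g ⌋ (∨ʳ ⌊ end₁ e ≟ end₂ g ⌋ (∨ˡ (fromWitness {a? = end₂ e ≟ end₁ g} eq)))
  shareEnd-incident {e = e} {g} (inj₂ refl) (inj₂ eq) =
    ∨ʳ ⌊ end₁ e ≟ end₁ g ⌋ (∨ʳ ⌊ end₁ e ≟ end₂ g ⌋ (∨ʳ ⌊ end₂ e ≟ end₁ g ⌋ (fromWitness {a? = end₂ e ≟ end₂ g} eq)))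

  neighbour∈hyperedge : ∀ {e g} → Neighbours e g → g ∈ hyperedge G e
  neighbour∈hyperedge {e} {g} (g≢e , _ , ve , vg) =
    ∈-tabulate⁺ (Equivalence.from T-∧ (fromWitnessFalse {a? = g ≟ e} g≢e , shareEnd-incident ve vg))

  ∈-inducedHyperedges⁻ : ∀ {X e} → e ∈ inducedHyperedges G X → hyperedge G e Subset.⊆ X
  ∈-inducedHyperedges⁻ {X} {e} e∈ = toWitness {a? = hyperedge G e ⊆? X} (∈-tabulate⁻ e∈)

  module _ (X : Subset m) where

    Y∖X-matching : IsMatching ((_∈ inducedHyperedges G X) ∖ (_∈ X))
    Y∖X-matching {e} {f} (e∈Y , _) (_ , f∉X) ve vf with f ≟ e
    ... | yes f≡e = sym f≡e
    ... | no  f≢e = contradiction (∈-inducedHyperedges⁻ e∈Y (neighbour∈hyperedge (f≢e , _ , ve , vf))) f∉X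

    boundary⊆X∖Y : Boundary ((_∈ inducedHyperedges G X) ∖ (_∈ X)) ⊆ (_∈ X) ∖ (_∈ inducedHyperedges G X)
    boundary⊆X∖Y (e , (e∈Y , e∉X) , e~g) =
      ∈-inducedHyperedges⁻ e∈Y (neighbour∈hyperedge e~g) ,
      λ g∈Y → e∉X (∈-inducedHyperedges⁻ g∈Y (neighbour∈hyperedge (neighbours-sym e~g)))

corollary4p5 : ∀ {n m : ℕ} (G : Graph n m) → 0 < m → Connected G →
    ¬ (IsTree G × HasPerfectMatching G) →
    EdgeDensityAtMostOne G
corollary4p5 G 0<m conn not-tree X _ =
  ↣⇒∣p∣≤∣q∣ (∖↣∖⇒↣ (_∈? X) (↣-mono (boundary⊆X∖Y G X)
    (matching↣boundary G (end₁ G (fromℕ< 0<m)) conn Y∖X? (Y∖X-matching G X) λ (tree , pm) → not-tree (tree , _ , pm))))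
  where
  Y∖X? = (_∈? inducedHyperedges G X) ∩? ∁? (_∈? X)
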